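{- For every $n\ge 1$ and every $s\in\{0,\dots,n-1\}$ there exists a bipartite bitrade $B_s\subseteq Q_3^n$ with $|B_s|=2^{n+1}-2^{s+1}$.
   Context: Let $Q_k=\{0,1,\dots,k-1\}$ and $Q_k^n$ the set of words of length $n$ over $Q_k$. $\Gamma Q_k^n$ denotes the graph on $Q_k^n$ with edges between words at Hamming distance $1$. A one-dimensional face of direction $i$ through $(a_1,\dots,a_n)$ is $\{(a_1,\dots,a_{i-1},x,a_{i+1},\dots,a_n): x\in Q_k\}$. A set $B\subseteq Q_k^n$ is a latin bitrade if $|B\cap F|\in\{0,2\}$ for every one-dimensional face $F$; it is a bipartite bitrade if moreover the subgraph of $\Gamma Q_k^n$ induced by $B$ is bipartite. -}

module Defs where

open import Data.Nat using (ℕ; zero; suc; _+_)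
open import Data.Bool using (Bool; true; false; T)
open import Data.Fin using (Fin)
open import Data.Fin.Properties using (_≟_)
open import Data.Vec using (Vec; []; _∷_; _[_]≔_)
open import Data.List using (List; []; _∷_; map; concatMap; length; filter)
open import Data.List using (allFin)
open import Data.Product using (Σ; _×_)
open import Data.Sum using (_⊎_)
open import Relation.Nullary.Decidable using (does)
open import Relation.Binary.PropositionalEquality using (_≡_; _≢_)

Word : ℕ → ℕ → Set
Word k n = Vec (Fin k) n

Subset : ℕ → ℕ → Set
Subset k n = Word k n → Bool

allWords : (k n : ℕ) → List (Word k n)
allWords k zero = [] ∷ []
allWords k (suc n) = concatMap (λ x → map (x ∷_) (allWords k n)) (allFin k)

countBy : {A : Set} → (A → Bool) → List A → ℕ
countBy p [] = 0
countBy p (x ∷ xs) with p x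
... | true = suc (countBy p xs)
... | false = countBy p xs

card : {k n : ℕ} → Subset k n → ℕ
card {k} {n} B = countBy B (allWords k n)

hamming : {k n : ℕ} → Word k n → Word k n → ℕ
hamming [] [] = 0
hamming (x ∷ u) (y ∷ v) with does (x ≟ y)
... | true = hamming u v
... | false = suc (hamming u v)

Adjacent : {k n : ℕ} → Word k n → Word k n → Set
Adjacent u v = hamming u v ≡ 1

face : {k n : ℕ} → Fin n → Word k n → List (Word k n)
face {k} i a = map (λ x → a [ i ]≔ x) (allFin k)

LatinBitrade : {k n : ℕ} → Subset k n → Set
LatinBitrade {k} {n} B =
  (i : Fin n) (a : Word k n) →
  countBy B (face i a) ≡ 0 ⊎ countBy B (face i a) ≡ 2

InducedBipartite : {k n : ℕ} → Subset k n → Set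
InducedBipartite {k} {n} B =
  Σ (Word k n → Bool) λ c →
    (u v : Word k n) → T (B u) → T (B v) → Adjacent u v → c u ≢ c v

BipartiteBitrade : {k n : ℕ} → Subset k n → Set
BipartiteBitrade B = LatinBitrade B × InducedBipartite B

-- Take P = {0,1}ⁿ and Q = {0,1}ˢ × {1,2}ⁿ⁻ˢ (in Q₃ⁿ) and B = P Δ Q.  A line meets
-- each of P and Q in 0 or 2 points, and two such subsets of a 3-element line have a
-- symmetric difference of size 0 or 2, so B is a latin bitrade.  Since |P| = |Q| = 2ⁿ
-- and |P ∩ Q| = 2ˢ, |B| = 2ⁿ⁺¹ − 2ˢ⁺¹.  Colour a word by the parity of its number of
-- ones, flipped on P.  An edge of B inside P or inside Q ∖ P changes a 0 into a 1 or
-- a 1 into a 2, so it flips the parity but not membership in P; an edge between P ∖ Q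
-- and Q ∖ P cannot change a 1 into a 2 (the endpoint with the 1 would lie in P ∩ Q),
-- so it changes a 0 into a 2 and flips membership in P but not the parity.
module Submission where

open import Defs
open import Data.Nat using (ℕ; zero; suc; _+_; _*_; _<_; _≤_; _^_; _∸_)
open import Data.Nat.Properties using (+-suc; +-identityʳ; m+n∸n≡m; m+[n∸m]≡n; <⇒≤; suc-injective)
open import Data.Nat.Tactic.RingSolver using (solve-∀)
open import Data.Bool using (Bool; true; false; T; _∧_; _xor_)
open import Data.Bool.Properties using (∧-assoc; ∧-comm; ∧-zeroʳ; xor-assoc; xor-comm; not-injective)
open import Data.Fin using (Fin; zero; suc)
open import Data.Fin.Patterns using (0F; 1F; 2F)
open import Data.Fin.Properties using (_≟_)
open import Data.Vec using (Vec; []; _∷_; _[_]≔_; lookup; map; replicate; _++_)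
open import Data.Vec.Properties using ([]≔-lookup; lookup-replicate; lookup-map)
open import Data.List using (List; []; _∷_; concatMap; allFin)
open import Data.Nat.ListAction using (sum)
import Data.List as List
import Data.List.Properties as List
open import Data.Product using (Σ; _×_; _,_; ∃-syntax)
open import Data.Sum using (_⊎_; inj₁; inj₂)
open import Relation.Nullary using (yes; no)
open import Relation.Binary.PropositionalEquality
  using (_≡_; refl; sym; trans; cong; cong₂; subst; _≢_; module ≡-Reasoning)

open ≡-Reasoning

countBy-++ : {A : Set} (p : A → Bool) (xs ys : List A) →
  countBy p (xs List.++ ys) ≡ countBy p xs + countBy p ys
countBy-++ p [] ys = refl
countBy-++ p (x ∷ xs) ys with p x
... | true = cong suc (countBy-++ p xs ys)
... | false = countBy-++ p xs ys

countBy-map : {A B : Set} (p : B → Bool) (f : A → B) (xs : List A) →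
  countBy p (List.map f xs) ≡ countBy (λ x → p (f x)) xs
countBy-map p f [] = refl
countBy-map p f (x ∷ xs) with p (f x)
... | true = cong suc (countBy-map p f xs)
... | false = countBy-map p f xs

countBy-cong : {A : Set} {p q : A → Bool} → (∀ x → p x ≡ q x) → (xs : List A) →
  countBy p xs ≡ countBy q xs
countBy-cong {p = p} {q} p≗q [] = refl
countBy-cong {p = p} {q} p≗q (x ∷ xs) with p x | q x | p≗q x
... | true | true | refl = cong suc (countBy-cong p≗q xs)
... | false | false | refl = countBy-cong p≗q xs

countBy-false : {A : Set} (xs : List A) → countBy (λ _ → false) xs ≡ 0
countBy-false [] = refl
countBy-false (x ∷ xs) = countBy-false xs

countBy-concatMap : {A B : Set} (p : B → Bool) (f : A → List B) (xs : List A) →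
  countBy p (concatMap f xs) ≡ sum (List.map (λ x → countBy p (f x)) xs)
countBy-concatMap p f [] = refl
countBy-concatMap p f (x ∷ xs) =
  trans (countBy-++ p (f x) _) (cong (countBy p (f x) +_) (countBy-concatMap p f xs))

countBy-xor : {A : Set} (p q : A → Bool) (xs : List A) →
  countBy (λ x → p x xor q x) xs + 2 * countBy (λ x → p x ∧ q x) xs ≡
  countBy p xs + countBy q xs
countBy-xor p q [] = refl
countBy-xor p q (x ∷ xs) with p x | q x
... | false | false = countBy-xor p q xs
... | true | false = cong suc (countBy-xor p q xs)
... | false | true = trans (cong suc (countBy-xor p q xs)) (sym (+-suc _ _))
... | true | true = begin
  c + 2 * suc d           ≡⟨ +2*suc c d ⟩
  suc (suc (c + 2 * d))   ≡⟨ cong (λ k → suc (suc k)) (countBy-xor p q xs) ⟩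
  suc (suc (a + b))       ≡⟨ cong suc (sym (+-suc a b)) ⟩
  suc a + suc b           ∎
  where
  a = countBy p xs
  b = countBy q xs
  c = countBy (λ x → p x xor q x) xs
  d = countBy (λ x → p x ∧ q x) xs
  +2*suc : ∀ m n → m + 2 * suc n ≡ suc (suc (m + 2 * n))
  +2*suc = solve-∀

card-∅ : {k : ℕ} (n : ℕ) → card {k} {n} (λ _ → false) ≡ 0
card-∅ {k} n = countBy-false (allWords k n)

card-∷ : {k n : ℕ} (S : Subset k (suc n)) →
  card S ≡ sum (List.map (λ x → card (λ u → S (x ∷ u))) (allFin k))
card-∷ {k} {n} S =
  trans (countBy-concatMap S (λ x → List.map (x ∷_) (allWords k n)) (allFin k))
        (cong sum (List.map-cong (λ x → countBy-map S (x ∷_) (allWords k n)) (allFin k)))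

card-xor : {k n : ℕ} (S T : Subset k n) →
  card (λ u → S u xor T u) + 2 * card (λ u → S u ∧ T u) ≡ card S + card T
card-xor {k} {n} S T = countBy-xor S T (allWords k n)

box : {k n : ℕ} → Vec (Fin k → Bool) n → Subset k n
box [] [] = true
box (A ∷ As) (x ∷ u) = A x ∧ box As u

box-line : {k n : ℕ} (As : Vec (Fin k → Bool) n) (i : Fin n) (u : Word k n) →
  ∃[ r ] ∀ y → box As (u [ i ]≔ y) ≡ r ∧ lookup As i y
box-line (A ∷ As) zero (x ∷ u) = box As u , λ y → ∧-comm (A y) (box As u)
box-line (A ∷ As) (suc i) (x ∷ u) with box-line As i u
... | r , eq = A x ∧ r , λ y → trans (cong (A x ∧_) (eq y)) (sym (∧-assoc (A x) r _))

data Side : Set where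
  lower upper : Side

⟦_⟧ : Side → Fin 3 → Bool
⟦ lower ⟧ 0F = true
⟦ lower ⟧ 1F = true
⟦ lower ⟧ 2F = false
⟦ upper ⟧ 0F = false
⟦ upper ⟧ 1F = true
⟦ upper ⟧ 2F = true

cube : {n : ℕ} → Vec Side n → Subset 3 n
cube cs = box (map ⟦_⟧ cs)

cube-line : {n : ℕ} (cs : Vec Side n) (i : Fin n) (u : Word 3 n) →
  ∃[ r ] ∀ y → cube cs (u [ i ]≔ y) ≡ r ∧ ⟦ lookup cs i ⟧ y
cube-line cs i u with box-line (map ⟦_⟧ cs) i u
... | r , eq = r , λ y → trans (eq y) (cong (λ A → r ∧ A y) (lookup-map i ⟦_⟧ cs))

lowerCube : (n : ℕ) → Subset 3 n
lowerCube n = cube (replicate n lower)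

isOne : Fin 3 → Bool
isOne 1F = true
isOne _ = false

oddOnes : {n : ℕ} → Word 3 n → Bool
oddOnes [] = false
oddOnes (x ∷ u) = isOne x xor oddOnes u

oddOnes-line : {n : ℕ} (i : Fin n) (u : Word 3 n) →
  ∃[ r ] ∀ y → oddOnes (u [ i ]≔ y) ≡ r xor isOne y
oddOnes-line zero (x ∷ u) = oddOnes u , λ y → xor-comm (isOne y) (oddOnes u)
oddOnes-line (suc i) (x ∷ u) with oddOnes-line i u
... | r , eq =
  isOne x xor r , λ y → trans (cong (isOne x xor_) (eq y)) (sym (xor-assoc (isOne x) r _))

bitrade : {n : ℕ} → Vec Side n → Subset 3 n
bitrade {n} cs u = lowerCube n u xor cube cs u

colour : {n : ℕ} → Word 3 n → Bool
colour {n} u = oddOnes u xor lowerCube n u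

-- Along a line in direction i, B traces trace c p q and the colouring is r xor shade p,
-- where c is the i-th side of Q and p, q record whether the remaining coordinates lie
-- in P resp. Q.
trace : Side → Bool → Bool → Fin 3 → Bool
trace c p q y = (p ∧ ⟦ lower ⟧ y) xor (q ∧ ⟦ c ⟧ y)

shade : Bool → Fin 3 → Bool
shade p y = isOne y xor (p ∧ ⟦ lower ⟧ y)

record LineView {n : ℕ} (cs : Vec Side n) (i : Fin n) (u : Word 3 n) : Set where
  field
    p q r : Bool
    bitrade-line : ∀ y → bitrade cs (u [ i ]≔ y) ≡ trace (lookup cs i) p q y
    colour-line : ∀ y → colour (u [ i ]≔ y) ≡ r xor shade p y

lineView : {n : ℕ} (cs : Vec Side n) (i : Fin n) (u : Word 3 n) → LineView cs i u
lineView {n} cs i u with cube-line (replicate n lower) i u | cube-line cs i u | oddOnes-line i u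
... | p , P≡ | q , Q≡ | r , R≡ = record
  { p = p ; q = q ; r = r
  ; bitrade-line = λ y → cong₂ _xor_ (lowerCube-line y) (Q≡ y)
  ; colour-line = λ y → trans (cong₂ _xor_ (R≡ y) (lowerCube-line y)) (xor-assoc r (isOne y) _)
  }
  where
  lowerCube-line : ∀ y → lowerCube n (u [ i ]≔ y) ≡ p ∧ ⟦ lower ⟧ y
  lowerCube-line y = trans (P≡ y) (cong (λ c → p ∧ ⟦ c ⟧ y) (lookup-replicate i lower))

trace-zeroOrTwo : ∀ c p q →
  countBy (trace c p q) (allFin 3) ≡ 0 ⊎ countBy (trace c p q) (allFin 3) ≡ 2
trace-zeroOrTwo lower false false = inj₁ refl
trace-zeroOrTwo lower false true = inj₂ refl
trace-zeroOrTwo lower true false = inj₂ refl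
trace-zeroOrTwo lower true true = inj₁ refl
trace-zeroOrTwo upper false false = inj₁ refl
trace-zeroOrTwo upper false true = inj₂ refl
trace-zeroOrTwo upper true false = inj₂ refl
trace-zeroOrTwo upper true true = inj₂ refl

shade-injective : ∀ c p q x y → T (trace c p q x) → T (trace c p q y) →
  shade p x ≡ shade p y → x ≡ y
shade-injective _ _ _ 0F 0F _ _ _ = refl
shade-injective _ _ _ 1F 1F _ _ _ = refl
shade-injective _ _ _ 2F 2F _ _ _ = refl
shade-injective _ false _ 0F 1F _ _ ()
shade-injective _ true _ 0F 1F _ _ ()
shade-injective _ false _ 1F 0F _ _ ()
shade-injective _ true _ 1F 0F _ _ ()
shade-injective _ true _ 0F 2F _ _ ()
shade-injective _ true _ 2F 0F _ _ ()
shade-injective _ false _ 1F 2F _ _ ()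
shade-injective _ false _ 2F 1F _ _ ()
shade-injective _ false false 0F 2F () _ _
shade-injective _ false false 2F 0F _ () _
shade-injective lower false true 0F 2F _ () _
shade-injective lower false true 2F 0F () _ _
shade-injective upper false true 0F 2F () _ _
shade-injective upper false true 2F 0F _ () _
shade-injective _ true false 1F 2F _ () _
shade-injective _ true false 2F 1F () _ _
shade-injective lower true true 1F 2F _ () _
shade-injective lower true true 2F 1F () _ _
shade-injective upper true true 1F 2F () _ _
shade-injective upper true true 2F 1F _ () _

bitrade-latin : {n : ℕ} (cs : Vec Side n) → LatinBitrade (bitrade cs)
bitrade-latin cs i a =
  subst (λ k → k ≡ 0 ⊎ k ≡ 2) (sym face-count) (trace-zeroOrTwo (lookup cs i) p q)
  where
  open LineView (lineView cs i a)
  face-count : countBy (bitrade cs) (face i a) ≡ countBy (trace (lookup cs i) p q) (allFin 3)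
  face-count = trans (countBy-map (bitrade cs) (a [ i ]≔_) (allFin 3))
                     (countBy-cong bitrade-line (allFin 3))

hamming-0⇒≡ : {k n : ℕ} (u v : Word k n) → hamming u v ≡ 0 → u ≡ v
hamming-0⇒≡ [] [] _ = refl
hamming-0⇒≡ (x ∷ u) (y ∷ v) d≡0 with x ≟ y
... | yes refl = cong (x ∷_) (hamming-0⇒≡ u v d≡0)

adjacent⇒line : {k n : ℕ} (u v : Word k n) → Adjacent u v →
  ∃[ i ] v ≡ u [ i ]≔ lookup v i × lookup u i ≢ lookup v i
adjacent⇒line [] [] ()
adjacent⇒line (x ∷ u) (y ∷ v) d≡1 with x ≟ y
... | yes refl with adjacent⇒line u v d≡1
...   | i , v≡ , x≢y = suc i , cong (x ∷_) v≡ , x≢y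
adjacent⇒line (x ∷ u) (y ∷ v) d≡1 | no x≢y =
  zero , cong (y ∷_) (sym (hamming-0⇒≡ u v (suc-injective d≡1))) , x≢y

xor-cancelˡ : ∀ r {a b} → r xor a ≡ r xor b → a ≡ b
xor-cancelˡ false eq = eq
xor-cancelˡ true eq = not-injective eq

bitrade-bipartite : {n : ℕ} (cs : Vec Side n) → InducedBipartite (bitrade cs)
bitrade-bipartite cs = colour , proper
  where
  proper : ∀ u v → T (bitrade cs u) → T (bitrade cs v) → Adjacent u v → colour u ≢ colour v
  proper u v Bu Bv adj same with adjacent⇒line u v adj
  ... | i , v≡ , x≢y =
    x≢y (shade-injective (lookup cs i) p q (lookup u i) (lookup v i)
          (subst T (bitrade-at u≡) Bu) (subst T (bitrade-at v≡) Bv)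
          (xor-cancelˡ r (trans (sym (colour-at u≡)) (trans same (colour-at v≡)))))
    where
    open LineView (lineView cs i u)
    u≡ : u ≡ u [ i ]≔ lookup u i
    u≡ = sym ([]≔-lookup u i)
    bitrade-at : ∀ {w y} → w ≡ u [ i ]≔ y → bitrade cs w ≡ trace (lookup cs i) p q y
    bitrade-at refl = bitrade-line _
    colour-at : ∀ {w y} → w ≡ u [ i ]≔ y → colour w ≡ r xor shade p y
    colour-at refl = colour-line _

card-cube : {n : ℕ} (cs : Vec Side n) → card (cube cs) ≡ 2 ^ n
card-cube [] = refl
card-cube {suc n} (lower ∷ cs) =
  trans (card-∷ (cube (lower ∷ cs))) (cong₂ _+_ ih (cong₂ _+_ ih (cong (_+ 0) (card-∅ n))))
  where ih = card-cube cs
card-cube {suc n} (upper ∷ cs) =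
  trans (card-∷ (cube (upper ∷ cs))) (cong₂ _+_ (card-∅ n) (cong₂ _+_ ih (cong (_+ 0) ih)))
  where ih = card-cube cs

sides : (s m : ℕ) → Vec Side (s + m)
sides s m = replicate s lower ++ replicate m upper

card-lowerCube∩upperCube : (m : ℕ) →
  card (λ u → lowerCube m u ∧ cube (replicate m upper) u) ≡ 1
card-lowerCube∩upperCube zero = refl
card-lowerCube∩upperCube (suc m) =
  trans (card-∷ (λ u → lowerCube (suc m) u ∧ cube (replicate (suc m) upper) u))
        (cong₂ _+_ (trans (countBy-cong (λ u → ∧-zeroʳ (lowerCube m u)) (allWords 3 m))
                          (card-∅ m))
                   (cong₂ _+_ (card-lowerCube∩upperCube m) (cong (_+ 0) (card-∅ m))))

card-lowerCube∩sides : (s m : ℕ) →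
  card (λ u → lowerCube (s + m) u ∧ cube (sides s m) u) ≡ 2 ^ s
card-lowerCube∩sides zero m = card-lowerCube∩upperCube m
card-lowerCube∩sides (suc s) m =
  trans (card-∷ (λ u → lowerCube (suc s + m) u ∧ cube (sides (suc s) m) u))
        (cong₂ _+_ ih (cong₂ _+_ ih (cong (_+ 0) (card-∅ (s + m)))))
  where ih = card-lowerCube∩sides s m

card-bitrade-sides : (s m : ℕ) → card (bitrade (sides s m)) ≡ 2 ^ suc (s + m) ∸ 2 ^ suc s
card-bitrade-sides s m = begin
  card B                          ≡⟨ sym (m+n∸n≡m (card B) (2 ^ suc s)) ⟩
  card B + 2 ^ suc s ∸ 2 ^ suc s  ≡⟨ cong (_∸ 2 ^ suc s) inclusion–exclusion ⟩
  2 ^ suc n ∸ 2 ^ suc s           ∎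
  where
  n = s + m
  P = lowerCube n
  Q = cube (sides s m)
  B = bitrade (sides s m)
  inclusion–exclusion : card B + 2 ^ suc s ≡ 2 ^ suc n
  inclusion–exclusion = begin
    card B + 2 * 2 ^ s
      ≡⟨ cong (λ k → card B + 2 * k) (sym (card-lowerCube∩sides s m)) ⟩
    card B + 2 * card (λ u → P u ∧ Q u)
      ≡⟨ card-xor P Q ⟩
    card P + card Q
      ≡⟨ cong₂ _+_ (card-cube (replicate n lower)) (card-cube (sides s m)) ⟩
    2 ^ n + 2 ^ n
      ≡⟨ cong (2 ^ n +_) (sym (+-identityʳ (2 ^ n))) ⟩
    2 ^ suc n
      ∎

bipartiteBitrade-sides : (s m : ℕ) →
  Σ (Subset 3 (s + m)) λ B → BipartiteBitrade B × card B ≡ 2 ^ suc (s + m) ∸ 2 ^ suc s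
bipartiteBitrade-sides s m =
  bitrade (sides s m) , (bitrade-latin (sides s m) , bitrade-bipartite (sides s m)) ,
  card-bitrade-sides s m

-- The construction only needs s ≤ n; for s = n the bitrade is empty.
proposition7 : (n : ℕ) → 1 ≤ n → (s : ℕ) → s < n →
    Σ (Subset 3 n) λ B →
    BipartiteBitrade B × card B ≡ 2 ^ suc n ∸ 2 ^ suc s
proposition7 n _ s s<n =
  subst (λ n → Σ (Subset 3 n) λ B → BipartiteBitrade B × card B ≡ 2 ^ suc n ∸ 2 ^ suc s)
        (m+[n∸m]≡n (<⇒≤ s<n))
        (bipartiteBitrade-sides s (n ∸ s))
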